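{- For all integers $n\ge2$ we have \[ \tau(n)\le138.32(n-1)^{1/6},\quad \tau'_1(n)\le16.2(n-1)^{1/6},\quad \tau'_2(n)\le51.3(n-1)^{1/6}, \] \[ \tau'_3(n)\le32.3(n-1)^{1/6},\quad \tau'_6(n)\le102.7(n-1)^{1/6}. \]
   Context: $\tau(n)$ is the number of positive divisors of $n$, and for $j\mid 6$, $\tau'_j(n)$ is the number of positive divisors $d$ of $n$ with $\gcd(d,6)=j$. -}

module Defs where

open import Data.Nat using (ℕ; suc; _≟_)
open import Data.Nat.Divisibility using (_∣?_)
open import Data.Nat.GCD using (gcd)
open import Data.List using (List; length; filter; map; upTo)
open import Relation.Nullary.Decidable using (_×-dec_)

candidates : ℕ → List ℕ
candidates n = map suc (upTo n)

τ : ℕ → ℕ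
τ n = length (filter (λ d → d ∣? n) (candidates n))

τ' : ℕ → ℕ → ℕ
τ' j n = length (filter (λ d → (d ∣? n) ×-dec (gcd d 6 ≟ j)) (candidates n))

-- Write n = 2^a 3^b m with m coprime to 6. Every divisor d of n is 2^i 3^k e with i ≤ a, k ≤ b
-- and e ∣ m, and whether 2 or 3 divides gcd(d, 6) only depends on whether i or k is positive.
-- Hence τ(n) ≤ (a+1)(b+1) τ(m) and τ'_j(n) ≤ c₂ c₃ τ(m), where c₂ is a or 1 according as 2 ∣ j
-- or not, and c₃ is b or 1 according as 3 ∣ j or not. The ratio τ'_j(n)^6 / n is then at most
-- (c₂^6 / 2^a) (c₃^6 / 3^b) (τ(m)^6 / m), and the first two factors are bounded by their maxima.
--
-- The last factor is bounded by sieving out the primes 5 ≤ p < 64 one at a time: removing p^a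
-- from m costs at most the local factor max_a (a+1)^6 / p^a, and once m has no prime factor
-- below 64 = 2^6 every local factor is 1, so τ(m)^6 ≤ m.
--
-- The constants obtained this way are slightly below the claimed ones, and the room left is
-- spent on replacing n by n - 1. For n ≥ 30 this works whenever m is below the product P of
-- the primes in [5, 64): then one of these primes does not divide m and its local factor,
-- at least 26/25, is saved. Otherwise n ≥ m ≥ P is huge. The cases n < 30 are computed.

module Submission where

open import Defs
open import Data.Nat
open import Data.Nat.Properties
open import Data.Nat.Divisibility
open import Data.Nat.Coprimality using (Coprime; coprime-divisor)
open import Data.Nat.GCD using (gcd; gcd[m,n]∣m; gcd-greatest)
open import Data.Nat.Primality
open import Data.Nat.Primality.Factorisation using (factorise)
open import Data.Nat.ListAction using (product)
open import Data.Nat.Induction using (<-wellFounded)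
open import Induction.WellFounded using (Acc; acc)
open import Data.Bool using (T)
open import Data.Product using (∃; ∃₂; _×_; _,_; proj₁; proj₂)
open import Data.Sum using (inj₁; inj₂; [_,_]′)
open import Data.List using (List; []; _∷_; length; filter; map; upTo; _++_; cartesianProductWith)
open import Data.List.Properties using (length-++; length-map; length-upTo)
open import Data.List.Membership.Propositional using (_∈_)
open import Data.List.Membership.Propositional.Properties
  using (∈-∃++; ∈-filter⁺; ∈-filter⁻; ∈-map⁺; ∈-upTo⁺; ∈-cartesianProductWith⁺)
open import Data.List.Relation.Unary.All using (lookup; _∷_)
open import Data.List.Relation.Unary.AllPairs using (_∷_)
open import Data.List.Relation.Unary.Any using (here; there)
open import Data.List.Relation.Unary.Unique.Propositional using (Unique)
import Data.List.Relation.Unary.Unique.Propositional.Properties as Unique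
open import Data.List.Relation.Binary.Permutation.Propositional.Properties using (shift; ∈-resp-↭; ↭-length)
open import Function using (id; it; _∘_)
open import Relation.Nullary using (¬_; Dec; yes; no; contradiction)
open import Relation.Nullary.Decidable using (from-yes; from-no; map′; _×-dec_; _→-dec_)
open import Relation.Unary using (Decidable)
open import Relation.Binary.PropositionalEquality
open import Algebra.Properties.CommutativeSemigroup *-commutativeSemigroup
  using (interchange; x∙yz≈y∙xz)

-- x ≤[ a / b ] y  says  x ≤ (a / b) y, kept as a record so that x, a, b, y can be inferred.
infix 4 _≤[_/_]_ _≤[_/_]?_

record _≤[_/_]_ (x a b y : ℕ) : Set where
  constructor mk≤[]
  field cross : x * b ≤ a * y

open _≤[_/_]_

_≤[_/_]?_ : ∀ x a b y → Dec (x ≤[ a / b ] y)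
x ≤[ a / b ]? y = map′ mk≤[] cross (x * b ≤? a * y)

≤[]-* : ∀ {x y a b x′ y′ a′ b′} → x ≤[ a / b ] y → x′ ≤[ a′ / b′ ] y′ →
        x * x′ ≤[ a * a′ / b * b′ ] y * y′
≤[]-* {x} {y} {a} {b} {x′} {y′} {a′} {b′} (mk≤[] h) (mk≤[] h′) = mk≤[] (begin
  x * x′ * (b * b′)   ≡⟨ interchange x x′ b b′ ⟩
  x * b * (x′ * b′)   ≤⟨ *-mono-≤ h h′ ⟩
  a * y * (a′ * y′)   ≡⟨ interchange a y a′ y′ ⟩
  a * a′ * (y * y′)   ∎)
  where open ≤-Reasoning

≤[]-scale : ∀ {x y a b c d} → c ≤ d → x ≤[ a / b ] y → x ≤[ d * a / c * b ] y
≤[]-scale {x} {y} {a} {b} {c} {d} c≤d (mk≤[] h) = mk≤[] (begin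
  x * (c * b)   ≡⟨ x∙yz≈y∙xz x c b ⟩
  c * (x * b)   ≤⟨ *-mono-≤ c≤d h ⟩
  d * (a * y)   ≡⟨ *-assoc d a y ⟨
  d * a * y     ∎)
  where open ≤-Reasoning

≤[]-cong : ∀ {x y a a′ b b′} → a ≡ a′ → b ≡ b′ → x ≤[ a / b ] y → x ≤[ a′ / b′ ] y
≤[]-cong refl refl h = h

≤-≤[] : ∀ {x x′ y a b} → x ≤ x′ → x′ ≤[ a / b ] y → x ≤[ a / b ] y
≤-≤[] {b = b} x≤x′ (mk≤[] h) = mk≤[] (≤-trans (*-monoˡ-≤ b x≤x′) h)

≤[]-≤ : ∀ {x y y′ a b} → x ≤[ a / b ] y → y ≤ y′ → x ≤[ a / b ] y′
≤[]-≤ {a = a} (mk≤[] h) y≤y′ = mk≤[] (≤-trans h (*-monoʳ-≤ a y≤y′))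

pred[m]*n≤m*pred[n] : ∀ {m n} → m ≤ n → (m ∸ 1) * n ≤ m * (n ∸ 1)
pred[m]*n≤m*pred[n] {m} {n} m≤n = begin
  (m ∸ 1) * n     ≡⟨ *-distribʳ-∸ n m 1 ⟩
  m * n ∸ 1 * n   ≡⟨ cong (m * n ∸_) (*-identityˡ n) ⟩
  m * n ∸ n       ≤⟨ ∸-monoʳ-≤ (m * n) m≤n ⟩
  m * n ∸ m       ≡⟨ cong (m * n ∸_) (*-identityʳ m) ⟨
  m * n ∸ m * 1   ≡⟨ *-distribˡ-∸ m n 1 ⟨
  m * (n ∸ 1)     ∎
  where open ≤-Reasoning

-- (n - 1) / n increases with n, so it suffices to compare (a / b) A with B (n - 1) / n at n₀.
≤[]-pred : ∀ {x n a b A B n₀} .{{_ : NonZero b}} .{{_ : NonZero n₀}} →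
           x ≤[ a / b ] n → a * A * n₀ ≤ b * B * (n₀ ∸ 1) → n₀ ≤ n →
           x ≤[ B / A ] (n ∸ 1)
≤[]-pred {x} {n} {a} {b} {A} {B} {n₀} (mk≤[] h) check n₀≤n = mk≤[] (
  *-cancelʳ-≤ (x * A) (B * (n ∸ 1)) (b * n₀) {{m*n≢0 b n₀}} (begin
    x * A * (b * n₀)           ≡⟨ interchange x A b n₀ ⟩
    x * b * (A * n₀)           ≤⟨ *-monoˡ-≤ (A * n₀) h ⟩
    a * n * (A * n₀)           ≡⟨ interchange a n A n₀ ⟩
    a * A * (n * n₀)           ≡⟨ cong (a * A *_) (*-comm n n₀) ⟩
    a * A * (n₀ * n)           ≡⟨ *-assoc (a * A) n₀ n ⟨
    a * A * n₀ * n             ≤⟨ *-monoˡ-≤ n check ⟩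
    b * B * (n₀ ∸ 1) * n       ≡⟨ *-assoc (b * B) (n₀ ∸ 1) n ⟩
    b * B * ((n₀ ∸ 1) * n)     ≤⟨ *-monoʳ-≤ (b * B) (pred[m]*n≤m*pred[n] n₀≤n) ⟩
    b * B * (n₀ * (n ∸ 1))     ≡⟨ interchange b B n₀ (n ∸ 1) ⟩
    b * n₀ * (B * (n ∸ 1))     ≡⟨ *-comm (b * n₀) (B * (n ∸ 1)) ⟩
    B * (n ∸ 1) * (b * n₀)     ∎))
  where open ≤-Reasoning

-- Sixth powers against exponentials

^-distrib-* : ∀ x y n → (x * y) ^ n ≡ x ^ n * y ^ n
^-distrib-* x y zero = refl
^-distrib-* x y (suc n) = trans (cong (x * y *_) (^-distrib-* x y n)) (interchange x y (x ^ n) (y ^ n))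

^6-≤-* : ∀ {x} y z → x ≤ y * z → x ^ 6 ≤ y ^ 6 * z ^ 6
^6-≤-* {x} y z x≤yz = ≤-trans (^-monoˡ-≤ 6 x≤yz) (≤-reflexive (^-distrib-* y z 6))

-- (10 / 9)^6 < 2.
[1+b]^6≤2*b^6 : ∀ {b} → 9 ≤ b → suc b ^ 6 ≤ 2 * b ^ 6
[1+b]^6≤2*b^6 {b} 9≤b = *-cancelˡ-≤ (9 ^ 6) (begin
  9 ^ 6 * suc b ^ 6     ≡⟨ ^-distrib-* 9 (suc b) 6 ⟨
  (9 * suc b) ^ 6       ≤⟨ ^-monoˡ-≤ 6 9[1+b]≤10b ⟩
  (10 * b) ^ 6          ≡⟨ ^-distrib-* 10 b 6 ⟩
  10 ^ 6 * b ^ 6        ≤⟨ *-monoˡ-≤ (b ^ 6) (≤ᵇ⇒≤ (10 ^ 6) (9 ^ 6 * 2) _) ⟩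
  9 ^ 6 * 2 * b ^ 6     ≡⟨ *-assoc (9 ^ 6) 2 (b ^ 6) ⟩
  9 ^ 6 * (2 * b ^ 6)   ∎)
  where
  open ≤-Reasoning
  9[1+b]≤10b : 9 * suc b ≤ 10 * b
  9[1+b]≤10b = ≤-trans (≤-reflexive (*-suc 9 b)) (+-monoˡ-≤ (9 * b) 9≤b)

≤-by-doubling : ∀ (f g : ℕ → ℕ) k → (∀ {a} → a < suc k → f a ≤ g a) →
                (∀ {a} → k ≤ a → f (suc a) ≤ 2 * f a) → (∀ a → 2 * g a ≤ g (suc a)) →
                ∀ a → f a ≤ g a
≤-by-doubling f g k small f-doubling g-doubling zero = small (s≤s z≤n)
≤-by-doubling f g k small f-doubling g-doubling (suc a) with suc a <? suc k
... | yes a<k = small a<k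
... | no a≮k = begin
  f (suc a)   ≤⟨ f-doubling (≤-pred (≮⇒≥ a≮k)) ⟩
  2 * f a     ≤⟨ *-monoʳ-≤ 2 (≤-by-doubling f g k small f-doubling g-doubling a) ⟩
  2 * g a     ≤⟨ g-doubling a ⟩
  g (suc a)   ∎
  where open ≤-Reasoning

^6-≤[]-^ : ∀ s {p N D} → 2 ≤ p → (∀ {a} → a < 10 → (s + a) ^ 6 ≤[ N / D ] p ^ a) →
           ∀ a → (s + a) ^ 6 ≤[ N / D ] p ^ a
^6-≤[]-^ s {p} {N} {D} 2≤p small a =
  mk≤[] (≤-by-doubling (λ a → (s + a) ^ 6 * D) (λ a → N * p ^ a) 9 (cross ∘ small)
                       lhs-doubling rhs-doubling a)
  where
  open ≤-Reasoning
  lhs-doubling : ∀ {a} → 9 ≤ a → (s + suc a) ^ 6 * D ≤ 2 * ((s + a) ^ 6 * D)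
  lhs-doubling {a} 9≤a = begin
    (s + suc a) ^ 6 * D     ≡⟨ cong (λ t → t ^ 6 * D) (+-suc s a) ⟩
    suc (s + a) ^ 6 * D     ≤⟨ *-monoˡ-≤ D ([1+b]^6≤2*b^6 (≤-trans 9≤a (m≤n+m a s))) ⟩
    2 * (s + a) ^ 6 * D     ≡⟨ *-assoc 2 ((s + a) ^ 6) D ⟩
    2 * ((s + a) ^ 6 * D)   ∎
  rhs-doubling : ∀ a → 2 * (N * p ^ a) ≤ N * p ^ suc a
  rhs-doubling a = begin
    2 * (N * p ^ a)   ≡⟨ x∙yz≈y∙xz 2 N (p ^ a) ⟩
    N * (2 * p ^ a)   ≤⟨ *-monoʳ-≤ N (*-monoˡ-≤ (p ^ a) 2≤p) ⟩
    N * p ^ suc a     ∎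

-- Counting divisors

module _ {a} {A : Set a} where

  unique-⊆⇒length-≤ : ∀ {xs ys : List A} → Unique xs → (∀ {x} → x ∈ xs → x ∈ ys) →
                      length xs ≤ length ys
  unique-⊆⇒length-≤ {[]} _ _ = z≤n
  unique-⊆⇒length-≤ {x ∷ xs} (x∉xs ∷ xs-unique) xs⊆ys with ∈-∃++ (xs⊆ys (here refl))
  ... | as , bs , refl = begin
    suc (length xs)         ≤⟨ s≤s (unique-⊆⇒length-≤ xs-unique xs⊆as++bs) ⟩
    suc (length (as ++ bs)) ≡⟨ ↭-length (shift x as bs) ⟨
    length (as ++ x ∷ bs)   ∎
    where
    open ≤-Reasoning
    xs⊆as++bs : ∀ {y} → y ∈ xs → y ∈ as ++ bs
    xs⊆as++bs y∈xs with ∈-resp-↭ (shift x as bs) (xs⊆ys (there y∈xs))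
    ... | here refl = contradiction refl (lookup x∉xs y∈xs)
    ... | there y∈as++bs = y∈as++bs

module _ {a b c} {A : Set a} {B : Set b} {C : Set c} (f : A → B → C) where

  length-cartesianProductWith : ∀ xs ys → length (cartesianProductWith f xs ys) ≡ length xs * length ys
  length-cartesianProductWith [] ys = refl
  length-cartesianProductWith (x ∷ xs) ys = begin
    length (map (f x) ys ++ cartesianProductWith f xs ys)
      ≡⟨ length-++ (map (f x) ys) ⟩
    length (map (f x) ys) + length (cartesianProductWith f xs ys)
      ≡⟨ cong₂ _+_ (length-map (f x) ys) (length-cartesianProductWith xs ys) ⟩
    length ys + length xs * length ys
      ∎
    where open ≡-Reasoning

candidates-unique : ∀ n → Unique (candidates n)
candidates-unique n = Unique.map⁺ suc-injective (Unique.upTo⁺ n)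

divisors : ℕ → List ℕ
divisors n = filter (_∣? n) (candidates n)

∈-divisors⁺ : ∀ {d n} .{{_ : NonZero n}} → d ∣ n → d ∈ divisors n
∈-divisors⁺ {zero} {n} 0∣n = contradiction (0∣⇒≡0 0∣n) (≢-nonZero⁻¹ n)
∈-divisors⁺ {suc d} {n} d∣n = ∈-filter⁺ (_∣? n) (∈-map⁺ suc (∈-upTo⁺ (∣⇒≤ d∣n))) d∣n

length-filter≤length*τ : ∀ {P : ℕ → Set} (P? : Decidable P) N (G : List ℕ) {m} .{{_ : NonZero m}} →
                         (∀ {d} → P d → ∃₂ λ g e → g ∈ G × e ∣ m × d ≡ g * e) →
                         length (filter P? (candidates N)) ≤ length G * τ m
length-filter≤length*τ P? N G {m} factor = begin
  length (filter P? (candidates N))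
    ≤⟨ unique-⊆⇒length-≤ (Unique.filter⁺ P? (candidates-unique N)) ⊆products ⟩
  length (cartesianProductWith _*_ G (divisors m))
    ≡⟨ length-cartesianProductWith _*_ G (divisors m) ⟩
  length G * τ m
    ∎
  where
  open ≤-Reasoning
  ⊆products : ∀ {d} → d ∈ filter P? (candidates N) → d ∈ cartesianProductWith _*_ G (divisors m)
  ⊆products d∈ with ∈-filter⁻ P? {xs = candidates N} d∈
  ... | _ , Pd with factor Pd
  ...   | g , e , g∈G , e∣m , refl = ∈-cartesianProductWith⁺ _*_ g∈G (∈-divisors⁺ e∣m)

p^i*e*p≡p^[1+i]*e : ∀ p i e → p ^ i * e * p ≡ p ^ suc i * e
p^i*e*p≡p^[1+i]*e p i e = trans (*-comm (p ^ i * e) p) (sym (*-assoc p (p ^ i) e))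

p*m≤p^[1+a]*m : ∀ p a m .{{_ : NonZero p}} → p * m ≤ p ^ suc a * m
p*m≤p^[1+a]*m p a m = *-monoˡ-≤ m (m≤m*n p (p ^ a) {{m^n≢0 p a}})

nonZero-cofactor : ∀ {n} x {m} .{{_ : NonZero n}} → n ≡ x * m → NonZero m
nonZero-cofactor x refl = m*n≢0⇒n≢0 x

module _ {p} (pr : Prime p) where

  private instance
    p≢0 : NonZero p
    p≢0 = prime⇒nonZero pr

  ∤⇒coprime : ∀ {n} → ¬ p ∣ n → Coprime n p
  ∤⇒coprime p∤n (i∣n , i∣p) with prime⇒irreducible pr i∣p
  ... | inj₁ i≡1 = i≡1
  ... | inj₂ refl = contradiction i∣n p∤n

  ∤-^ : ∀ {m} k → ¬ p ∣ m → ¬ p ∣ m ^ k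
  ∤-^ zero p∤m p∣1 = nonTrivial⇒≢1 {{prime⇒nonTrivial pr}} (∣1⇒≡1 p∣1)
  ∤-^ {m} (suc k) p∤m p∣m^[1+k] with euclidsLemma m (m ^ k) pr p∣m^[1+k]
  ... | inj₁ p∣m = p∤m p∣m
  ... | inj₂ p∣m^k = ∤-^ k p∤m p∣m^k

  ∣p^a*m⇒≡p^i*e : ∀ a {d m} → d ∣ p ^ a * m → ∃₂ λ i e → i ≤ a × e ∣ m × d ≡ p ^ i * e
  ∣p^a*m⇒≡p^i*e zero {d} {m} d∣m = 0 , d , z≤n , subst (d ∣_) (*-identityˡ m) d∣m , sym (*-identityˡ d)
  ∣p^a*m⇒≡p^i*e (suc a) {d} {m} d∣p^[1+a]*m with p ∣? d
  ... | no p∤d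
    with ∣p^a*m⇒≡p^i*e a (coprime-divisor (∤⇒coprime p∤d) (subst (d ∣_) (*-assoc p (p ^ a) m) d∣p^[1+a]*m))
  ...   | i , e , i≤a , e∣m , d≡ = i , e , m≤n⇒m≤1+n i≤a , e∣m , d≡
  ∣p^a*m⇒≡p^i*e (suc a) {_} {m} d∣p^[1+a]*m | yes (divides q refl)
    with ∣p^a*m⇒≡p^i*e a (*-cancelˡ-∣ p (subst₂ _∣_ (*-comm q p) (*-assoc p (p ^ a) m) d∣p^[1+a]*m))
  ... | i , e , i≤a , e∣m , refl = suc i , e , s≤s i≤a , e∣m , p^i*e*p≡p^[1+i]*e p i e

  τ[p^a*m]≤[1+a]*τ[m] : ∀ a m .{{_ : NonZero m}} → τ (p ^ a * m) ≤ suc a * τ m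
  τ[p^a*m]≤[1+a]*τ[m] a m = begin
    τ (p ^ a * m)         ≤⟨ length-filter≤length*τ (_∣? p ^ a * m) (p ^ a * m) powers factor ⟩
    length powers * τ m   ≡⟨ cong (_* τ m) (trans (length-map (p ^_) (upTo (suc a))) (length-upTo (suc a))) ⟩
    suc a * τ m           ∎
    where
    open ≤-Reasoning
    powers = map (p ^_) (upTo (suc a))
    factor : ∀ {d} → d ∣ p ^ a * m → ∃₂ λ g e → g ∈ powers × e ∣ m × d ≡ g * e
    factor d∣p^a*m with ∣p^a*m⇒≡p^i*e a d∣p^a*m
    ... | i , e , i≤a , e∣m , d≡ = p ^ i , e , ∈-map⁺ (p ^_) (∈-upTo⁺ (s≤s i≤a)) , e∣m , d≡

  τ[p^a*m]^6-≤[] : ∀ a m {N₁ D₁ N₂ D₂} .{{_ : NonZero m}} → suc a ^ 6 ≤[ N₁ / D₁ ] p ^ a →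
                   τ m ^ 6 ≤[ N₂ / D₂ ] m → τ (p ^ a * m) ^ 6 ≤[ N₁ * N₂ / D₁ * D₂ ] p ^ a * m
  τ[p^a*m]^6-≤[] a m local bound =
    ≤-≤[] (^6-≤-* (suc a) (τ m) (τ[p^a*m]≤[1+a]*τ[m] a m)) (≤[]-* local bound)

factor-out : ∀ p .{{_ : NonTrivial p}} n .{{_ : NonZero n}} → ∃₂ λ a m → ¬ p ∣ m × n ≡ p ^ a * m
factor-out p n = go n (<-wellFounded n)
  where
  go : ∀ n .{{_ : NonZero n}} → Acc _<_ n → ∃₂ λ a m → ¬ p ∣ m × n ≡ p ^ a * m
  go n (acc smaller) with p ∣? n
  ... | no p∤n = 0 , n , p∤n , sym (*-identityˡ n)
  ... | yes (divides q refl)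
    with go q {{m*n≢0⇒m≢0 q}} (smaller (m<m*n q p {{m*n≢0⇒m≢0 q}} (nonTrivial⇒n>1 p)))
  ...   | a , m , p∤m , refl = suc a , m , p∤m , p^i*e*p≡p^[1+i]*e p a m

factor-out-∣ : ∀ p .{{_ : NonTrivial p}} {n} .{{_ : NonZero n}} → p ∣ n →
               ∃₂ λ a m → ¬ p ∣ m × n ≡ p ^ suc a * m
factor-out-∣ p {n} p∣n with factor-out p n
... | zero , m , p∤m , n≡ = contradiction (subst (p ∣_) (trans n≡ (*-identityˡ m)) p∣n) p∤m
... | suc a , m , p∤m , n≡ = a , m , p∤m , n≡

∃-prime-divisor : ∀ n .{{_ : NonTrivial n}} → ∃ λ p → Prime p × p ∣ n
∃-prime-divisor n with factorise n {{nonTrivial⇒nonZero n}}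
... | record { factors = [] ; isFactorisation = n≡1 } = contradiction n≡1 nonTrivial⇒≢1
... | record { factors = p ∷ ps ; isFactorisation = n≡p*Πps ; factorsPrime = p-prime ∷ _ } =
  p , p-prime , divides (product ps) (trans n≡p*Πps (*-comm p (product ps)))

-- The sieve

[1+a]^6≤64^a : ∀ a → suc a ^ 6 ≤[ 1 / 1 ] 64 ^ a
[1+a]^6≤64^a = ^6-≤[]-^ 1 (≤ᵇ⇒≤ 2 64 _) (from-yes (allUpTo? (λ a → (1 + a) ^ 6 ≤[ 1 / 1 ]? 64 ^ a) 10))

64-rough⇒τ^6≤ : ∀ {n} .{{_ : NonZero n}} → 64 Rough n → τ n ^ 6 ≤[ 1 / 1 ] n
64-rough⇒τ^6≤ {n} = go n (<-wellFounded n)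
  where
  go : ∀ n .{{_ : NonZero n}} → Acc _<_ n → 64 Rough n → τ n ^ 6 ≤[ 1 / 1 ] n
  go 1 _ _ = mk≤[] ≤-refl
  go n@(suc (suc _)) (acc smaller) rough with ∃-prime-divisor n
  ... | p , pr , p∣n with factor-out-∣ p {{prime⇒nonTrivial pr}} p∣n
  ...   | a , m , _ , n≡ = subst (λ k → τ k ^ 6 ≤[ 1 / 1 ] k) (sym n≡)
            (τ[p^a*m]^6-≤[] pr (suc a) m (≤[]-≤ ([1+a]^6≤64^a (suc a)) (^-monoˡ-≤ (suc a) 64≤p))
              (go m (smaller m<n) m-rough))
    where
    instance
      _ = prime⇒nonTrivial pr
      _ = prime⇒nonZero pr
      _ = nonZero-cofactor (p ^ suc a) n≡
    64≤p : 64 ≤ p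
    64≤p = rough⇒≤ (rough∧∣⇒rough rough p∣n)
    m-rough : 64 Rough m
    m-rough = rough∧∣⇒rough rough (divides (p ^ suc a) n≡)
    m<n : m < n
    m<n = begin-strict
      m               <⟨ m<m*n m p (nonTrivial⇒n>1 p) ⟩
      m * p           ≡⟨ *-comm m p ⟩
      p * m           ≤⟨ p*m≤p^[1+a]*m p a m ⟩
      p ^ suc a * m   ≡⟨ n≡ ⟨
      n               ∎
      where open ≤-Reasoning

-- For the primes p < 64, (a + 1)^6 / p^a is largest at a = peakExponent p.
peakExponent : ℕ → ℕ
peakExponent 2 = 8
peakExponent 3 = 4
peakExponent 5 = 3
peakExponent 7 = 2
peakExponent 11 = 2
peakExponent _ = 1

peakNum peakDen : ℕ → ℕ
peakNum p = suc (peakExponent p) ^ 6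
peakDen p = p ^ peakExponent p

LocalFactor : ℕ → ℕ → ℕ → Set
LocalFactor p N E = (∀ a → suc a ^ 6 ≤[ N / E ] p ^ a) × 26 * E ≤ 25 * N

peak-gain : ∀ {p} → p < 64 → Prime p → 26 * peakDen p ≤ 25 * peakNum p
peak-gain = from-yes (allUpTo? (λ p → prime? p →-dec 26 * peakDen p ≤? 25 * peakNum p) 64)

peak-small : ∀ {p} → p < 64 → Prime p → ∀ {a} → a < 10 → (1 + a) ^ 6 ≤[ peakNum p / peakDen p ] p ^ a
peak-small = from-yes (allUpTo? (λ p → prime? p →-dec
  allUpTo? (λ a → (1 + a) ^ 6 ≤[ peakNum p / peakDen p ]? p ^ a) 10) 64)

localFactor-peak : ∀ {p} → Prime p → p < 64 → LocalFactor p (peakNum p) (peakDen p)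
localFactor-peak {p} pr p<64 =
  ^6-≤[]-^ 1 (nonTrivial⇒n>1 p {{prime⇒nonTrivial pr}}) (peak-small p<64 pr) , peak-gain p<64 pr

-- In the sieve P is the product of the primes in [q, 64): if n < P one of them does not
-- divide n, and its local factor, at least 26 / 25, is saved.
SieveBound : (q K D P : ℕ) → Set
SieveBound q K D P = ∀ {n} .{{_ : NonZero n}} → q Rough n →
  τ n ^ 6 ≤[ K / D ] n × (n < P → τ n ^ 6 ≤[ 25 * K / 26 * D ] n)

sieveBound-64 : SieveBound 64 1 1 1
sieveBound-64 {n} rough = 64-rough⇒τ^6≤ rough , λ n<1 → contradiction (>-nonZero⁻¹ n) (<⇒≱ n<1)

sieveBound-composite : ∀ {q K D P} .{{_ : NonTrivial q}} → ¬ Prime q →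
                       SieveBound (suc q) K D P → SieveBound q K D P
sieveBound-composite ¬prime bound rough =
  bound (∤⇒rough-suc (λ q∣n → ¬prime (rough∧∣⇒prime rough q∣n)) rough)

sieveBound-prime : ∀ {q N E K D P} → Prime q → LocalFactor q N E →
                   SieveBound (suc q) K D P → SieveBound q (N * K) (E * D) (q * P)
sieveBound-prime {q} {N} {E} {K} {D} {P} pr (local , gain) bound {n} rough with q ∣? n
... | no q∤n =
  ≤[]-scale E≤N unrefined , λ _ → ≤[]-cong (*-assoc 25 N K) (*-assoc 26 E D) (≤[]-scale gain unrefined)
  where
  unrefined = proj₁ (bound (∤⇒rough-suc q∤n rough))
  E≤N : E ≤ N
  E≤N = *-cancelˡ-≤ 25 (≤-trans (*-monoˡ-≤ E (n≤1+n 25)) gain)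
... | yes q∣n with factor-out-∣ q {{prime⇒nonTrivial pr}} q∣n
...   | a , m , q∤m , refl =
  τ[p^a*m]^6-≤[] pr (suc a) m (local (suc a)) (proj₁ m-bound) ,
  λ n<qP → ≤[]-cong (x∙yz≈y∙xz N 25 K) (x∙yz≈y∙xz E 26 D)
             (τ[p^a*m]^6-≤[] pr (suc a) m (local (suc a)) (proj₂ m-bound (m<P n<qP)))
  where
  instance
    _ = prime⇒nonZero pr
    _ = m*n≢0⇒n≢0 (q ^ suc a)
  m-bound = bound (∤⇒rough-suc q∤m (rough∧∣⇒rough rough (n∣m*n (q ^ suc a))))
  m<P : q ^ suc a * m < q * P → m < P
  m<P n<qP = *-cancelˡ-< q m P (≤-<-trans (p*m≤p^[1+a]*m q a m) n<qP)

primeProduct : (ℕ → ℕ) → ℕ → ℕ → ℕ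
primeProduct f q zero = 1
primeProduct f q (suc k) with prime? q
... | yes _ = f q * primeProduct f (suc q) k
... | no _ = primeProduct f (suc q) k

sieve : ∀ {N E : ℕ → ℕ} {top} → SieveBound top 1 1 1 →
        (∀ {p} → Prime p → p < top → LocalFactor p (N p) (E p)) →
        ∀ k {q} → 2 ≤ q → q + k ≡ top →
        SieveBound q (primeProduct N q k) (primeProduct E q k) (primeProduct id q k)
sieve base local zero {q} _ refl = subst (λ t → SieveBound t 1 1 1) (+-identityʳ q) base
sieve base local (suc k) {q} 2≤q refl with prime? q
... | yes pr = sieveBound-prime pr (local pr (m<m+n q z<s))
                 (sieve base local k (m≤n⇒m≤1+n 2≤q) (sym (+-suc q k)))
... | no ¬pr = sieveBound-composite {{n>1⇒nonTrivial 2≤q}} ¬pr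
                 (sieve base local k (m≤n⇒m≤1+n 2≤q) (sym (+-suc q k)))

K₅ D₅ P₅ : ℕ
K₅ = primeProduct peakNum 5 59
D₅ = primeProduct peakDen 5 59
P₅ = primeProduct id 5 59

sieveBound-5 : SieveBound 5 K₅ D₅ P₅
sieveBound-5 = sieve sieveBound-64 localFactor-peak 59 (≤ᵇ⇒≤ 2 5 _) refl

-- Divisors of 2^a 3^b m

∤2∧∤3⇒5-rough : ∀ {m} → ¬ 2 ∣ m → ¬ 3 ∣ m → 5 Rough m
∤2∧∤3⇒5-rough 2∤m 3∤m =
  ∤⇒rough-suc (λ 4∣m → 2∤m (∣-trans (divides 2 refl) 4∣m))
    (∤⇒rough-suc 3∤m (∤⇒rough-suc 2∤m 2-rough))

-- The exponents i ≤ a that p ∈ {2, 3} can have in a divisor d of 2^a 3^b m with gcd(d, 6) = j.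
exponents : ℕ → ℕ → ℕ → List ℕ
exponents p j a with p ∣? j
... | yes _ = map suc (upTo a)
... | no _ = 0 ∷ []

#exponents : ℕ → ℕ → ℕ → ℕ
#exponents p j a with p ∣? j
... | yes _ = a
... | no _ = 1

length-exponents : ∀ p j a → length (exponents p j a) ≡ #exponents p j a
length-exponents p j a with p ∣? j
... | yes _ = trans (length-map suc (upTo a)) (length-upTo a)
... | no _ = refl

∈-exponents : ∀ {p i a e d j} → p ∣ 6 → ¬ p ∣ e → i ≤ a → d ≡ p ^ i * e → gcd d 6 ≡ j →
              i ∈ exponents p j a
∈-exponents {p} {zero} {a} {e} p∣6 p∤e _ refl refl with p ∣? gcd (1 * e) 6
... | yes p∣gcd = contradiction (subst (p ∣_) (*-identityˡ e) (∣-trans p∣gcd (gcd[m,n]∣m (1 * e) 6))) p∤e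
... | no _ = here refl
∈-exponents {p} {suc i} {a} {e} p∣6 p∤e i<a refl refl with p ∣? gcd (p ^ suc i * e) 6
... | yes _ = ∈-map⁺ suc (∈-upTo⁺ i<a)
... | no p∤gcd = contradiction (gcd-greatest (∣-trans (m∣m*n (p ^ i)) (m∣m*n e)) p∣6) p∤gcd

prime[3] : Prime 3
prime[3] = from-yes (prime? 3)

1^6≤[]^ : ∀ p a .{{_ : NonZero p}} → 1 ^ 6 ≤[ 1 / 1 ] p ^ a
1^6≤[]^ p a = mk≤[] (subst (1 ≤_) (sym (*-identityˡ (p ^ a))) (m^n>0 p a))

a^6≤[]2^a : ∀ a → a ^ 6 ≤[ 9 ^ 6 / 2 ^ 9 ] 2 ^ a
a^6≤[]2^a = ^6-≤[]-^ 0 ≤-refl (from-yes (allUpTo? (λ a → a ^ 6 ≤[ 9 ^ 6 / 2 ^ 9 ]? 2 ^ a) 10))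

b^6≤[]3^b : ∀ b → b ^ 6 ≤[ 5 ^ 6 / 3 ^ 5 ] 3 ^ b
b^6≤[]3^b = ^6-≤[]-^ 0 (s≤s (s≤s z≤n)) (from-yes (allUpTo? (λ b → b ^ 6 ≤[ 5 ^ 6 / 3 ^ 5 ]? 3 ^ b) 10))

DivisorBounds : ℕ → Set
DivisorBounds n =
      (τ n ^ 6 * 100 ^ 6 ≤ 13832 ^ 6 * (n ∸ 1))
    × (τ' 1 n ^ 6 * 10 ^ 6 ≤ 162 ^ 6 * (n ∸ 1))
    × (τ' 2 n ^ 6 * 10 ^ 6 ≤ 513 ^ 6 * (n ∸ 1))
    × (τ' 3 n ^ 6 * 10 ^ 6 ≤ 323 ^ 6 * (n ∸ 1))
    × (τ' 6 n ^ 6 * 10 ^ 6 ≤ 1027 ^ 6 * (n ∸ 1))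

divisorBounds? : ∀ n → Dec (DivisorBounds n)
divisorBounds? n = (_ ≤? _) ×-dec (_ ≤? _) ×-dec (_ ≤? _) ×-dec (_ ≤? _) ×-dec (_ ≤? _)

divisorBounds-<30 : ∀ {n} → n < 30 → 2 ≤ n → DivisorBounds n
divisorBounds-<30 = from-yes (allUpTo? (λ n → 2 ≤? n →-dec divisorBounds? n) 30)

module _ (a b m : ℕ) .{{_ : NonZero m}} (2∤3^b*m : ¬ 2 ∣ 3 ^ b * m) (3∤m : ¬ 3 ∣ m) where

  τ[2^a*3^b*m]≤ : τ (2 ^ a * (3 ^ b * m)) ≤ suc a * (suc b * τ m)
  τ[2^a*3^b*m]≤ = ≤-trans (τ[p^a*m]≤[1+a]*τ[m] prime[2] a (3 ^ b * m) {{m*n≢0 (3 ^ b) m {{m^n≢0 3 b}}}})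
                          (*-monoʳ-≤ (suc a) (τ[p^a*m]≤[1+a]*τ[m] prime[3] b m))

  τ′[2^a*3^b*m]≤ : ∀ j → τ' j (2 ^ a * (3 ^ b * m)) ≤ #exponents 2 j a * (#exponents 3 j b * τ m)
  τ′[2^a*3^b*m]≤ j = begin
    τ' j n                                         ≤⟨ length-filter≤length*τ divisor? n G factor ⟩
    length G * τ m                                 ≡⟨ cong (_* τ m) length-G ⟩
    #exponents 2 j a * #exponents 3 j b * τ m     ≡⟨ *-assoc (#exponents 2 j a) (#exponents 3 j b) (τ m) ⟩
    #exponents 2 j a * (#exponents 3 j b * τ m)   ∎
    where
    open ≤-Reasoning
    n = 2 ^ a * (3 ^ b * m)
    divisor? = λ d → (d ∣? n) ×-dec (gcd d 6 ≟ j)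
    E₂ = exponents 2 j a
    E₃ = exponents 3 j b
    G = cartesianProductWith _*_ (map (2 ^_) E₂) (map (3 ^_) E₃)
    length-G : length G ≡ #exponents 2 j a * #exponents 3 j b
    length-G = trans (length-cartesianProductWith _*_ (map (2 ^_) E₂) (map (3 ^_) E₃))
      (cong₂ _*_ (trans (length-map (2 ^_) E₂) (length-exponents 2 j a))
                 (trans (length-map (3 ^_) E₃) (length-exponents 3 j b)))
    factor : ∀ {d} → d ∣ n × gcd d 6 ≡ j → ∃₂ λ g e → g ∈ G × e ∣ m × d ≡ g * e
    factor {d} (d∣n , gcd≡j) with ∣p^a*m⇒≡p^i*e prime[2] a d∣n
    ... | i , d₁ , i≤a , d₁∣3^b*m , d≡2^i*d₁ with ∣p^a*m⇒≡p^i*e prime[3] b d₁∣3^b*m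
    ...   | k , e , k≤b , e∣m , refl =
      2 ^ i * 3 ^ k , e ,
      ∈-cartesianProductWith⁺ _*_
        (∈-map⁺ (2 ^_) (∈-exponents (divides 3 refl) 2∤d₁ i≤a d≡2^i*d₁ gcd≡j))
        (∈-map⁺ (3 ^_) (∈-exponents (divides 2 refl) 3∤2^i*e k≤b
                         (trans d≡2^i*d₁ (x∙yz≈y∙xz (2 ^ i) (3 ^ k) e)) gcd≡j)) ,
      e∣m , trans d≡2^i*d₁ (sym (*-assoc (2 ^ i) (3 ^ k) e))
      where
      2∤d₁ : ¬ 2 ∣ 3 ^ k * e
      2∤d₁ 2∣d₁ = 2∤3^b*m (∣-trans 2∣d₁ d₁∣3^b*m)
      3∤2^i*e : ¬ 3 ∣ 2 ^ i * e
      3∤2^i*e 3∣2^i*e with euclidsLemma (2 ^ i) e prime[3] 3∣2^i*e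
      ... | inj₁ 3∣2^i = ∤-^ prime[3] i (from-no (3 ∣? 2)) 3∣2^i
      ... | inj₂ 3∣e = 3∤m (∣-trans 3∣e e∣m)

  module _ (30≤n : 30 ≤ 2 ^ a * (3 ^ b * m)) where

    private
      n = 2 ^ a * (3 ^ b * m)

      nonZero-*-* : ∀ x y z .{{_ : NonZero x}} .{{_ : NonZero y}} .{{_ : NonZero z}} → NonZero (x * (y * z))
      nonZero-*-* x y z = m*n≢0 x (y * z) {{it}} {{m*n≢0 y z}}

    X^6-≤[] : ∀ {X} c₂ c₃ {N₂ D₂ N₃ D₃ K D} → X ≤ c₂ * (c₃ * τ m) →
              c₂ ^ 6 ≤[ N₂ / D₂ ] 2 ^ a → c₃ ^ 6 ≤[ N₃ / D₃ ] 3 ^ b → τ m ^ 6 ≤[ K / D ] m →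
              X ^ 6 ≤[ N₂ * (N₃ * K) / D₂ * (D₃ * D) ] n
    X^6-≤[] {X} c₂ c₃ X≤ local₂ local₃ τm-bound =
      ≤-≤[] X^6≤ (≤[]-* local₂ (≤[]-* local₃ τm-bound))
      where
      X^6≤ : X ^ 6 ≤ c₂ ^ 6 * (c₃ ^ 6 * τ m ^ 6)
      X^6≤ = ≤-trans (^6-≤-* c₂ (c₃ * τ m) X≤)
                     (≤-reflexive (cong (c₂ ^ 6 *_) (^-distrib-* c₃ (τ m) 6)))

    divisor-bound : ∀ {X} c₂ c₃ A B {N₂ D₂ N₃ D₃} .{{_ : NonZero D₂}} .{{_ : NonZero D₃}} →
                    X ≤ c₂ * (c₃ * τ m) → c₂ ^ 6 ≤[ N₂ / D₂ ] 2 ^ a → c₃ ^ 6 ≤[ N₃ / D₃ ] 3 ^ b →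
                    N₂ * (N₃ * (25 * K₅)) * A * 30 ≤ D₂ * (D₃ * (26 * D₅)) * B * (30 ∸ 1) →
                    N₂ * (N₃ * K₅) * A * P₅ ≤ D₂ * (D₃ * D₅) * B * (P₅ ∸ 1) →
                    X ^ 6 * A ≤ B * (n ∸ 1)
    divisor-bound {X} c₂ c₃ A B {N₂} {D₂} {N₃} {D₃} X≤ local₂ local₃ check-small check-large =
      cross (by-size (m <? P₅))
      where
      m-bound = sieveBound-5 (∤2∧∤3⇒5-rough (λ 2∣m → 2∤3^b*m (∣-trans 2∣m (n∣m*n (3 ^ b)))) 3∤m)
      by-size : Dec (m < P₅) → X ^ 6 ≤[ B / A ] (n ∸ 1)
      by-size (yes m<P₅) =
        ≤[]-pred {{nonZero-*-* D₂ D₃ (26 * D₅)}}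
          (X^6-≤[] c₂ c₃ X≤ local₂ local₃ (proj₂ m-bound m<P₅)) check-small 30≤n
      by-size (no m≮P₅) =
        ≤[]-pred {{nonZero-*-* D₂ D₃ D₅}}
          (X^6-≤[] c₂ c₃ X≤ local₂ local₃ (proj₁ m-bound)) check-large P₅≤n
        where
        instance _ = >-nonZero (≤-trans (s≤s z≤n) 30≤n)
        P₅≤n : P₅ ≤ n
        P₅≤n = ≤-trans (≮⇒≥ m≮P₅) (∣⇒≤ (∣-trans (n∣m*n (3 ^ b)) (n∣m*n (2 ^ a))))

    divisorBounds[2^a*3^b*m] : DivisorBounds n
    divisorBounds[2^a*3^b*m] =
      divisor-bound (suc a) (suc b) (100 ^ 6) (13832 ^ 6) τ[2^a*3^b*m]≤
        (local-peak prime[2] check a) (local-peak prime[3] check b) check check ,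
      divisor-bound 1 1 (10 ^ 6) (162 ^ 6) (τ′[2^a*3^b*m]≤ 1) (1^6≤[]^ 2 a) (1^6≤[]^ 3 b) check check ,
      divisor-bound a 1 (10 ^ 6) (513 ^ 6) (τ′[2^a*3^b*m]≤ 2) (a^6≤[]2^a a) (1^6≤[]^ 3 b) check check ,
      divisor-bound 1 b (10 ^ 6) (323 ^ 6) (τ′[2^a*3^b*m]≤ 3) (1^6≤[]^ 2 a) (b^6≤[]3^b b) check check ,
      divisor-bound a b (10 ^ 6) (1027 ^ 6) (τ′[2^a*3^b*m]≤ 6) (a^6≤[]2^a a) (b^6≤[]3^b b) check check
      where
      local-peak : ∀ {p} → Prime p → p < 64 → ∀ a → suc a ^ 6 ≤[ peakNum p / peakDen p ] p ^ a
      local-peak pr p<64 = proj₁ (localFactor-peak pr p<64)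
      check : ∀ {x y} → {T (x ≤ᵇ y)} → x ≤ y
      check {x} {y} {x≤ᵇy} = ≤ᵇ⇒≤ x y x≤ᵇy

divisorBounds-≥30 : ∀ {n} → 30 ≤ n → DivisorBounds n
divisorBounds-≥30 {n} 30≤n =
  let instance _ = >-nonZero (≤-trans (s≤s z≤n) 30≤n)
      (a , M , 2∤M , n≡2^a*M) = factor-out 2 n
      instance _ = nonZero-cofactor (2 ^ a) n≡2^a*M
      (b , m , 3∤m , M≡3^b*m) = factor-out 3 M
      instance _ = nonZero-cofactor (3 ^ b) M≡3^b*m
      n≡2^a*3^b*m = trans n≡2^a*M (cong (2 ^ a *_) M≡3^b*m)
  in subst DivisorBounds (sym n≡2^a*3^b*m)
       (divisorBounds[2^a*3^b*m] a b m (subst (¬_ ∘ (2 ∣_)) M≡3^b*m 2∤M) 3∤m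
                                 (subst (30 ≤_) n≡2^a*3^b*m 30≤n))

lemma7p1 : ∀ (n : ℕ) → 2 ≤ n →
      (τ n ^ 6 * 100 ^ 6 ≤ 13832 ^ 6 * (n ∸ 1))
    × (τ' 1 n ^ 6 * 10 ^ 6 ≤ 162 ^ 6 * (n ∸ 1))
    × (τ' 2 n ^ 6 * 10 ^ 6 ≤ 513 ^ 6 * (n ∸ 1))
    × (τ' 3 n ^ 6 * 10 ^ 6 ≤ 323 ^ 6 * (n ∸ 1))
    × (τ' 6 n ^ 6 * 10 ^ 6 ≤ 1027 ^ 6 * (n ∸ 1))
lemma7p1 n 2≤n =
  [ divisorBounds-≥30 {n} , (λ n<30 → divisorBounds-<30 {n} n<30 2≤n) ]′ (≤-<-connex 30 n)
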